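{- Let $\mathcal{G}$ be a hereditary class of graphs such that every graph in $\mathcal{G}$ is diamond-free. If every prime graph in $\mathcal{G}$ is recolorable, then every graph in $\mathcal{G}$ is recolorable.
   Context: Graphs are finite and simple. A class is hereditary if closed under induced subgraphs. The diamond is $K_4$ minus one edge; a graph is diamond-free if it has no induced diamond. A $k$-coloring of $G$ is a map $V(G)\to\{1,\dots,k\}$ giving adjacent vertices different colors; $\chi(G)$ is the chromatic number. $R_\ell(G)$ is the graph whose vertices are the $\ell$-colorings of $G$, two adjacent if they differ on exactly one vertex. $G$ is recolorable if $R_\ell(G)$ is connected for every $\ell\ge\chi(G)+1$. A module is a non-empty $S\subseteq V(G)$ such that every vertex outside $S$ is adjacent to all or none of $S$; it is non-trivial if it is a proper subset of $V(G)$ with at least two vertices; $G$ is prime if it has no non-trivial module. -}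

module Defs where

open import Data.Nat using (ℕ; suc; _≤_; _+_)
open import Data.Fin using (Fin; zero; suc)
open import Data.Bool using (Bool; true; false)
open import Data.Product using (Σ; ∃; _×_; _,_)
open import Data.Sum using (_⊎_)
open import Data.Empty using (⊥)
open import Relation.Nullary using (¬_)
open import Relation.Binary.PropositionalEquality using (_≡_; _≢_)
open import Function.Definitions using (Injective)

record Graph (n : ℕ) : Set where
  field
    adj   : Fin n → Fin n → Bool
    sym   : ∀ u v → adj u v ≡ adj v u
    irrefl : ∀ v → adj v v ≡ false
open Graph public

Adj : ∀ {n} → Graph n → Fin n → Fin n → Set
Adj G u v = adj G u v ≡ true

record InducedEmbedding {m n} (H : Graph m) (G : Graph n) : Set where
  field
    f        : Fin m → Fin n
    inj      : Injective _≡_ _≡_ f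
    adj-pres : ∀ u v → adj G (f u) (f v) ≡ adj H u v

-- A class of graphs (closed under isomorphism is implied by hereditary below).
GraphClass : Set₁
GraphClass = ∀ {n} → Graph n → Set

Hereditary : GraphClass → Set
Hereditary 𝒢 = ∀ {m n} (H : Graph m) (G : Graph n) →
  InducedEmbedding H G → 𝒢 G → 𝒢 H

-- The diamond: K4 minus the edge {0,3}.
diamondAdj : Fin 4 → Fin 4 → Bool
diamondAdj zero zero = false
diamondAdj zero (suc (suc (suc zero))) = false
diamondAdj (suc (suc (suc zero))) zero = false
diamondAdj (suc zero) (suc zero) = false
diamondAdj (suc (suc zero)) (suc (suc zero)) = false
diamondAdj (suc (suc (suc zero))) (suc (suc (suc zero))) = false
diamondAdj _ _ = true

diamond : Graph 4
diamond = record
  { adj = diamondAdj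
  ; sym = s
  ; irrefl = i
  }
  where
  s : ∀ u v → diamondAdj u v ≡ diamondAdj v u
  s zero zero = Relation.Binary.PropositionalEquality.refl
  s zero (suc zero) = Relation.Binary.PropositionalEquality.refl
  s zero (suc (suc zero)) = Relation.Binary.PropositionalEquality.refl
  s zero (suc (suc (suc zero))) = Relation.Binary.PropositionalEquality.refl
  s (suc zero) zero = Relation.Binary.PropositionalEquality.refl
  s (suc zero) (suc zero) = Relation.Binary.PropositionalEquality.refl
  s (suc zero) (suc (suc zero)) = Relation.Binary.PropositionalEquality.refl
  s (suc zero) (suc (suc (suc zero))) = Relation.Binary.PropositionalEquality.refl
  s (suc (suc zero)) zero = Relation.Binary.PropositionalEquality.refl
  s (suc (suc zero)) (suc zero) = Relation.Binary.PropositionalEquality.refl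
  s (suc (suc zero)) (suc (suc zero)) = Relation.Binary.PropositionalEquality.refl
  s (suc (suc zero)) (suc (suc (suc zero))) = Relation.Binary.PropositionalEquality.refl
  s (suc (suc (suc zero))) zero = Relation.Binary.PropositionalEquality.refl
  s (suc (suc (suc zero))) (suc zero) = Relation.Binary.PropositionalEquality.refl
  s (suc (suc (suc zero))) (suc (suc zero)) = Relation.Binary.PropositionalEquality.refl
  s (suc (suc (suc zero))) (suc (suc (suc zero))) = Relation.Binary.PropositionalEquality.refl
  i : ∀ v → diamondAdj v v ≡ false
  i zero = Relation.Binary.PropositionalEquality.refl
  i (suc zero) = Relation.Binary.PropositionalEquality.refl
  i (suc (suc zero)) = Relation.Binary.PropositionalEquality.refl
  i (suc (suc (suc zero))) = Relation.Binary.PropositionalEquality.refl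

DiamondFree : ∀ {n} → Graph n → Set
DiamondFree G = ¬ InducedEmbedding diamond G

IsColoring : ∀ {n} (G : Graph n) (k : ℕ) → (Fin n → Fin k) → Set
IsColoring G k c = ∀ u v → Adj G u v → c u ≢ c v

Coloring : ∀ {n} → Graph n → ℕ → Set
Coloring {n} G k = Σ (Fin n → Fin k) (IsColoring G k)

Colorable : ∀ {n} → Graph n → ℕ → Set
Colorable G k = Coloring G k

IsChromaticNumber : ∀ {n} → Graph n → ℕ → Set
IsChromaticNumber G k = Colorable G k × (∀ j → Colorable G j → k ≤ j)

-- Adjacency in R_ℓ(G): the colorings differ on exactly one vertex.
DifferOnExactlyOne : ∀ {n k} → (Fin n → Fin k) → (Fin n → Fin k) → Set
DifferOnExactlyOne {n} c d =
  Σ (Fin n) λ v → (c v ≢ d v) × (∀ u → u ≢ v → c u ≡ d u)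

-- Connectivity in R_ℓ(G) (colorings compared pointwise).
data Reachable {n} (G : Graph n) (ℓ : ℕ) : Coloring G ℓ → Coloring G ℓ → Set where
  here : ∀ {α β : Coloring G ℓ} →
         (∀ v → Data.Product.proj₁ α v ≡ Data.Product.proj₁ β v) → Reachable G ℓ α β
  step : ∀ {α β γ : Coloring G ℓ} →
         DifferOnExactlyOne (Data.Product.proj₁ α) (Data.Product.proj₁ β) →
         Reachable G ℓ β γ → Reachable G ℓ α γ

RConnected : ∀ {n} → Graph n → ℕ → Set
RConnected G ℓ = ∀ (α β : Coloring G ℓ) → Reachable G ℓ α β

Recolorable : ∀ {n} → Graph n → Set
Recolorable G = ∀ k → IsChromaticNumber G k → ∀ ℓ → suc k ≤ ℓ → RConnected G ℓ

In : ∀ {n} → (Fin n → Bool) → Fin n → Set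
In S v = S v ≡ true

IsModule : ∀ {n} → Graph n → (Fin n → Bool) → Set
IsModule {n} G S =
  (Σ (Fin n) λ v → In S v) ×
  (∀ w → ¬ In S w →
     (∀ v → In S v → Adj G w v) ⊎ (∀ v → In S v → ¬ Adj G w v))

NonTrivialModule : ∀ {n} → Graph n → (Fin n → Bool) → Set
NonTrivialModule {n} G S =
  IsModule G S ×
  (Σ (Fin n) λ v → ¬ In S v) ×
  (Σ (Fin n) λ u → Σ (Fin n) λ v → u ≢ v × In S u × In S v)

Prime : ∀ {n} → Graph n → Set
Prime {n} G = ∀ (S : Fin n → Bool) → ¬ NonTrivialModule G S

{-# OPTIONS --safe #-}
-- Strengthen recolourability to: R_ℓ(G) is connected whenever G is k-colourable for some k < ℓ
-- (equivalent, since the chromatic number is computable), and argue by strong induction on the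
-- number of vertices. A graph that is not prime has a non-trivial module S. If no edge leaves S,
-- G is the disjoint union of G[S] and G[V ∖ S], and recolouring sequences of the two sides can be
-- played one after the other. Otherwise some w ∉ S is complete to S. If S contains an edge ab,
-- then a is simplicial: a neighbour y ≠ b of a is adjacent to b (by the module property if y ∉ S,
-- and since a, b, w, y would span a diamond if y ∈ S), and two non-adjacent neighbours of a would
-- span a diamond with a and b. If S is independent, any two u ≠ v in S have N(u) ⊆ N(v). Such a
-- vertex u can be deleted: every move of a recolouring sequence of G - u lifts to G once u is
-- moved out of the way, to the colour of v in the dominated case, and in the simplicial case to a
-- colour that is neither the target colour nor used on N(u), of which there are at most k - 1
-- because N[u] is a clique.

module Submission where

open import Defs
open import Data.Bool as Bool using (Bool; true; false; not)
open import Data.Bool.Properties using (¬-not)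
open import Data.Empty using (⊥; ⊥-elim)
open import Data.Fin using (Fin; zero; suc; punchIn; punchOut; inject≤)
open import Data.Fin.Patterns using (0F; 1F; 2F; 3F)
open import Data.Fin.Properties
  using (_≟_; any?; all?; pigeonhole; <⇒≢; suc-injective; inject≤-injective; injective⇒≤;
         punchIn-injective; punchInᵢ≢i; punchIn-punchOut; punchOut-injective)
open import Data.Nat using (ℕ; zero; suc; _≤_; _<_; z≤n; s≤s)
open import Data.Nat.Induction using (<-rec)
open import Data.Nat.Properties using (n<1+n; ≤-trans; ≰⇒>; ≮⇒≥; <⇒≱)
open import Data.Product as Product using (∃; _×_; _,_; proj₁)
open import Data.Sum as Sum using (_⊎_; inj₁; inj₂; [_,_]′)
open import Data.Unit using (tt)
open import Data.Vec.Functional using (updateAt; _∷_; head; tail)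
open import Data.Vec.Functional.Properties using (updateAt-updates; updateAt-minimal; ∷-cong)
open import Function using (_∘_; const; id)
open import Function.Definitions using (Injective)
open import Relation.Nullary using (¬_; Dec; yes; no)
open import Relation.Nullary.Decidable using (_×-dec_; _⊎-dec_; _→-dec_; ¬?; toWitness)
open import Relation.Unary using (Decidable)
open import Relation.Binary.PropositionalEquality as ≡
  using (_≡_; _≢_; _≗_; refl; cong; subst; subst₂; ≢-sym)

module _ {n} (G : Graph n) where

  adj-sym : ∀ {p q} → Adj G p q → Adj G q p
  adj-sym {p} {q} p~q = ≡.trans (Graph.sym G q p) p~q

  adj-irrefl : ∀ {p q} → Adj G p q → p ≢ q
  adj-irrefl {p} p~p refl with ≡.trans (≡.sym p~p) (irrefl G p)
  ... | ()

  Adj? : ∀ p q → Dec (Adj G p q)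
  Adj? p q = adj G p q Bool.≟ true

In? : ∀ {n} (S : Fin n → Bool) → Decidable (In S)
In? S v = S v Bool.≟ true

induced : ∀ {m n} → Graph n → (Fin m → Fin n) → Graph m
induced G f = record
  { adj = λ i j → adj G (f i) (f j)
  ; sym = λ i j → Graph.sym G (f i) (f j)
  ; irrefl = irrefl G ∘ f
  }

induced-embedding : ∀ {m n} (G : Graph n) {f : Fin m → Fin n} →
                    Injective _≡_ _≡_ f → InducedEmbedding (induced G f) G
induced-embedding G {f} f-injective =
  record { f = f ; inj = f-injective ; adj-pres = λ _ _ → refl }

_-_ : ∀ {n} → Graph (suc n) → Fin (suc n) → Graph n
G - u = induced G (punchIn u)

deletion-embedding : ∀ {n} (G : Graph (suc n)) u → InducedEmbedding (G - u) G
deletion-embedding G u = induced-embedding G λ {i} {j} → punchIn-injective u i j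

restrict : ∀ {m n k} (G : Graph n) (f : Fin m → Fin n) → Coloring G k → Coloring (induced G f) k
restrict G f (c , proper) = c ∘ f , λ i j → proper (f i) (f j)

-- Colourability and the chromatic number

Searchable : Set → Set₁
Searchable A = ∀ {P : A → Set} → Decidable P → Dec (∃ P)

search-Bool : Searchable Bool
search-Bool P? with P? true | P? false
... | yes p | _     = yes (true , p)
... | no _  | yes p = yes (false , p)
... | no ¬t | no ¬f = no λ { (true , p) → ¬t p ; (false , p) → ¬f p }

search-functions : ∀ {A} → Searchable A → ∀ n {P : (Fin n → A) → Set} →
                   (∀ {f g} → f ≗ g → P f → P g) → Decidable P → Dec (∃ P)
search-functions search zero resp P? with P? (λ ())
... | yes p = yes (_ , p)
... | no ¬p = no λ (f , pf) → ¬p (resp (λ ()) pf)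
search-functions search (suc n) {P} resp P?
  with search (λ x → search-functions search n {P ∘ (x ∷_)} (resp ∘ ∷-cong refl) (P? ∘ (x ∷_)))
... | yes (x , f , p) = yes (x ∷ f , p)
... | no ¬p = no λ (f , pf) → ¬p (head f , tail f , resp (∷-cong refl λ _ → refl) pf)

colorable? : ∀ {n} (G : Graph n) k → Dec (Colorable G k)
colorable? {n} G k =
  search-functions any? n resp λ c → all? λ u → all? λ v → Adj? G u v →-dec ¬? (c u ≟ c v)
  where
  resp : ∀ {c d} → c ≗ d → IsColoring G k c → IsColoring G k d
  resp c≗d proper u v u~v = proper u v u~v ∘ subst₂ _≡_ (≡.sym (c≗d u)) (≡.sym (c≗d v))

colorable-mono : ∀ {n j k} {G : Graph n} → j ≤ k → Colorable G j → Colorable G k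
colorable-mono j≤k (c , proper) =
  (λ v → inject≤ (c v) j≤k) , λ u v u~v → proper u v u~v ∘ inject≤-injective j≤k j≤k _ _

chromatic-number : ∀ {n} (G : Graph n) k → Colorable G k → ∃ (IsChromaticNumber G)
chromatic-number G zero colorable = zero , colorable , λ _ _ → z≤n
chromatic-number G (suc k) colorable with colorable? G k
... | yes colorable′ = chromatic-number G k colorable′
... | no ¬colorable′ =
  suc k , colorable ,
  λ j colorable-j → ≰⇒> λ j≤k → ¬colorable′ (colorable-mono {G = G} j≤k colorable-j)

RecolorableAbove : ∀ {n} → Graph n → Set
RecolorableAbove G = ∀ {k ℓ} → Colorable G k → k < ℓ → RConnected G ℓ

recolorableAbove⇒recolorable : ∀ {n} (G : Graph n) → RecolorableAbove G → Recolorable G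
recolorableAbove⇒recolorable G recolorable k (colorable , _) ℓ k<ℓ = recolorable colorable k<ℓ

recolorable⇒recolorableAbove : ∀ {n} (G : Graph n) → Recolorable G → RecolorableAbove G
recolorable⇒recolorableAbove G recolorable {k} colorable k<ℓ
  with χ , χ-colorable , χ-least ← chromatic-number G k colorable =
  recolorable χ (χ-colorable , χ-least) _ (≤-trans (s≤s (χ-least k colorable)) k<ℓ)

module _ {n} {G : Graph n} {ℓ : ℕ} where

  reachable-refl : ∀ {α} → Reachable G ℓ α α
  reachable-refl = here λ _ → refl

  reachable-trans : ∀ {α β γ} → Reachable G ℓ α β → Reachable G ℓ β γ → Reachable G ℓ α γ
  reachable-trans (here α≗β) β⇝γ = respˡ α≗β β⇝γ
    where
    respˡ : ∀ {α β γ} → proj₁ α ≗ proj₁ β → Reachable G ℓ β γ → Reachable G ℓ α γ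
    respˡ α≗β (here β≗γ) = here λ v → ≡.trans (α≗β v) (β≗γ v)
    respˡ α≗β (step (v , differ , agree) β′⇝γ) =
      step (v , differ ∘ ≡.trans (≡.sym (α≗β v)) , λ w w≢v → ≡.trans (α≗β w) (agree w w≢v))
           β′⇝γ
  reachable-trans (step move α′⇝β) β⇝γ = step move (reachable-trans α′⇝β β⇝γ)

  reachable-if-agree-off : ∀ {α β} v → (∀ w → w ≢ v → proj₁ α w ≡ proj₁ β w) → Reachable G ℓ α β
  reachable-if-agree-off {α} {β} v agree with proj₁ α v ≟ proj₁ β v
  ... | no differ = step (v , differ , agree) reachable-refl
  ... | yes same = here everywhere
    where
    everywhere : proj₁ α ≗ proj₁ β
    everywhere w with w ≟ v
    ... | yes refl = same
    ... | no w≢v = agree w w≢v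

module _ {n} (G : Graph n) {ℓ : ℕ} where

  proper-update : (α : Coloring G ℓ) → ∀ v x → (∀ q → Adj G v q → x ≢ proj₁ α q) →
                  IsColoring G ℓ (updateAt (proj₁ α) v (const x))
  proper-update (c , proper) v x fresh p q p~q with p ≟ v | q ≟ v
  ... | yes refl | yes refl = ⊥-elim (adj-irrefl G p~q refl)
  ... | yes refl | no q≢v =
    subst₂ _≢_ (≡.sym (updateAt-updates p c)) (≡.sym (updateAt-minimal q p c q≢v)) (fresh q p~q)
  ... | no p≢v | yes refl =
    subst₂ _≢_ (≡.sym (updateAt-minimal p q c p≢v)) (≡.sym (updateAt-updates q c))
      (≢-sym (fresh p (adj-sym G p~q)))
  ... | no p≢v | no q≢v =
    subst₂ _≢_ (≡.sym (updateAt-minimal p v c p≢v)) (≡.sym (updateAt-minimal q v c q≢v))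
      (proper p q p~q)

  recolour : (α : Coloring G ℓ) → ∀ v x → (∀ q → Adj G v q → x ≢ proj₁ α q) → Coloring G ℓ
  recolour α v x fresh = updateAt (proj₁ α) v (const x) , proper-update α v x fresh

  recolour-reachable : ∀ (α : Coloring G ℓ) v x fresh → Reachable G ℓ α (recolour α v x fresh)
  recolour-reachable (c , _) v x _ =
    reachable-if-agree-off v λ w w≢v → ≡.sym (updateAt-minimal w v c w≢v)

-- Lifting recolouring sequences from induced subgraphs

module Lifting {m n} (G : Graph n) (f : Fin m → Fin n) (ℓ : ℕ) (Fixed : Fin n → Set) where

  Lift : Coloring G ℓ → Coloring (induced G f) ℓ → Set
  Lift α γ = ∃ λ α′ → Reachable G ℓ α α′ × proj₁ α′ ∘ f ≗ proj₁ γ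
                    × (∀ v → Fixed v → proj₁ α′ v ≡ proj₁ α v)

  AgreeExcept : Coloring G ℓ → Coloring (induced G f) ℓ → Fin m → Set
  AgreeExcept α γ i = ∀ j → j ≢ i → proj₁ α (f j) ≡ proj₁ γ j

  StepLift : Set
  StepLift = ∀ α γ i → AgreeExcept α γ i → Lift α γ

  lift-prepend : ∀ {α α₁ γ} → Reachable G ℓ α α₁ →
                 (∀ v → Fixed v → proj₁ α₁ v ≡ proj₁ α v) → Lift α₁ γ → Lift α γ
  lift-prepend α⇝α₁ fixed₁ (α₂ , α₁⇝α₂ , α₂∘f≗γ , fixed₂) =
    α₂ , reachable-trans α⇝α₁ α₁⇝α₂ , α₂∘f≗γ ,
    λ v fixed → ≡.trans (fixed₂ v fixed) (fixed₁ v fixed)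

  lift-path : StepLift → ∀ {γ γ′} → Reachable (induced G f) ℓ γ γ′ →
              ∀ α → proj₁ α ∘ f ≗ proj₁ γ → Lift α γ′
  lift-path lift (here γ≗γ′) α α∘f≗γ =
    α , reachable-refl , (λ i → ≡.trans (α∘f≗γ i) (γ≗γ′ i)) , λ _ _ → refl
  lift-path lift {γ′ = γ′} (step {β = γ₁} (i , _ , γ≗γ₁-off-i) γ₁⇝γ′) α α∘f≗γ
    with α₁ , α⇝α₁ , α₁∘f≗γ₁ , fixed₁
           ← lift α γ₁ i (λ j j≢i → ≡.trans (α∘f≗γ j) (γ≗γ₁-off-i j j≢i)) =
    lift-prepend {γ = γ′} α⇝α₁ fixed₁ (lift-path lift γ₁⇝γ′ α₁ α₁∘f≗γ₁)

  move-target-fresh : ∀ α (γ : Coloring (induced G f) ℓ) i → AgreeExcept α γ i →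
                      ∀ j → Adj G (f i) (f j) → proj₁ γ i ≢ proj₁ α (f j)
  move-target-fresh α (c , proper) i agree j fi~fj with j ≟ i
  ... | yes refl = ⊥-elim (adj-irrefl G fi~fj refl)
  ... | no j≢i = λ same → proper i j fi~fj (≡.trans same (agree j j≢i))

  lift-move : Injective _≡_ _≡_ f → ∀ α γ i → AgreeExcept α γ i →
              (fresh : ∀ q → Adj G (f i) q → proj₁ γ i ≢ proj₁ α q) →
              (∀ v → Fixed v → v ≢ f i) → Lift α γ
  lift-move f-injective α γ i agree fresh moved-not-fixed =
    recolour G α (f i) (proj₁ γ i) fresh , recolour-reachable G α _ _ fresh , moved ,
    λ v fixed → updateAt-minimal v (f i) (proj₁ α) (moved-not-fixed v fixed)
    where
    moved : ∀ j → updateAt (proj₁ α) (f i) (const (proj₁ γ i)) (f j) ≡ proj₁ γ j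
    moved j with j ≟ i
    ... | yes refl = updateAt-updates (f i) (proj₁ α)
    ... | no j≢i =
      ≡.trans (updateAt-minimal (f j) (f i) (proj₁ α) (j≢i ∘ f-injective)) (agree j j≢i)

-- Deleting a simplicial or dominated vertex

module Deletion {m} (G : Graph (suc m)) (u : Fin (suc m)) (ℓ : ℕ) where
  open Lifting G (punchIn u) ℓ (const ⊥)

  punchIn-onto : ∀ {w} → w ≢ u → ∃ λ j → punchIn u j ≡ w
  punchIn-onto w≢u = punchOut (≢-sym w≢u) , punchIn-punchOut (≢-sym w≢u)

  agree-off : ∀ {A : Set} (c d : Fin (suc m) → A) → c ∘ punchIn u ≗ d ∘ punchIn u →
              ∀ w → w ≢ u → c w ≡ d w
  agree-off c d c≗d w w≢u with j , refl ← punchIn-onto w≢u = c≗d j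

  -- To lift a move of t to colour x from G - u, u first moves to a colour y that is free at u
  -- and, when t ~ u, differs from x.
  SpareColour : Set
  SpareColour = ∀ (α : Coloring G ℓ) t x → (∀ q → q ≢ u → Adj G t q → x ≢ proj₁ α q) →
                ∃ λ y → (∀ q → Adj G u q → y ≢ proj₁ α q) × (Adj G t u → x ≢ y)

  move-target-fresh-off-u : ∀ α (γ : Coloring (G - u) ℓ) i → AgreeExcept α γ i →
                            ∀ q → q ≢ u → Adj G (punchIn u i) q → proj₁ γ i ≢ proj₁ α q
  move-target-fresh-off-u α γ i agree q q≢u t~q
    with j , refl ← punchIn-onto q≢u = move-target-fresh α γ i agree j t~q

  lift-move-after-recolouring-u : ∀ α γ i → AgreeExcept α γ i →
                                  ∀ y (y-fresh : ∀ q → Adj G u q → y ≢ proj₁ α q) →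
                                  (Adj G (punchIn u i) u → proj₁ γ i ≢ y) → Lift α γ
  lift-move-after-recolouring-u α γ i agree y y-fresh avoids-y =
    lift-prepend {γ = γ} (recolour-reachable G α u y y-fresh) (λ _ ())
      (lift-move (λ {j} {k} → punchIn-injective u j k) α₁ γ i agree₁ fresh₁ (λ _ ()))
    where
    α₁ = recolour G α u y y-fresh
    agree₁ : AgreeExcept α₁ γ i
    agree₁ j j≢i = ≡.trans (updateAt-minimal _ u (proj₁ α) (punchInᵢ≢i u j)) (agree j j≢i)
    fresh₁ : ∀ q → Adj G (punchIn u i) q → proj₁ γ i ≢ proj₁ α₁ q
    fresh₁ q t~q with q ≟ u
    ... | yes refl = subst (proj₁ γ i ≢_) (≡.sym (updateAt-updates u (proj₁ α))) (avoids-y t~q)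
    ... | no q≢u = move-target-fresh-off-u α₁ γ i agree₁ q q≢u t~q

  step-lift : SpareColour → StepLift
  step-lift spare α γ i agree =
    let y , y-fresh , avoids-y =
          spare α (punchIn u i) (proj₁ γ i) (move-target-fresh-off-u α γ i agree)
    in lift-move-after-recolouring-u α γ i agree y y-fresh avoids-y

  deletion-connected : SpareColour → RConnected (G - u) ℓ → RConnected G ℓ
  deletion-connected spare connected α β =
    let α′ , α⇝α′ , α′≗β , _ =
          lift-path (step-lift spare) (connected (restrict G _ α) (restrict G _ β)) α (λ _ → refl)
    in reachable-trans α⇝α′ (reachable-if-agree-off u (agree-off (proj₁ α′) (proj₁ β) α′≗β))

Simplicial : ∀ {n} → Graph n → Fin n → Set
Simplicial G a = ∀ p q → Adj G a p → Adj G a q → p ≢ q → Adj G p q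

clique-bound : ∀ {n k ℓ} {G : Graph n} → Coloring G k → (p : Fin ℓ → Fin n) →
               (∀ {i j} → i ≢ j → Adj G (p i) (p j)) → ℓ ≤ k
clique-bound (d , proper) p clique = ≮⇒≥ λ k<ℓ →
  let i , j , i<j , same = pigeonhole k<ℓ (d ∘ p)
  in proper (p i) (p j) (clique (<⇒≢ i<j)) same

simplicial-closed-clique : ∀ {n} {G : Graph n} {a p q} → Simplicial G a →
                           p ≡ a ⊎ Adj G a p → q ≡ a ⊎ Adj G a q → p ≢ q → Adj G p q
simplicial-closed-clique simp (inj₁ refl) (inj₁ refl) p≢q = ⊥-elim (p≢q refl)
simplicial-closed-clique simp (inj₁ refl) (inj₂ a~q) _ = a~q
simplicial-closed-clique {G = G} simp (inj₂ a~p) (inj₁ refl) _ = adj-sym G a~p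
simplicial-closed-clique simp (inj₂ a~p) (inj₂ a~q) p≢q = simp _ _ a~p a~q p≢q

-- If no such y existed, every colour but x would occur on N(a) and x on a, making N[a] a clique
-- of size ℓ > k.
simplicial-free-colour : ∀ {n k ℓ} {G : Graph n} {a} → Simplicial G a → Coloring G k → k < ℓ →
                         (α : Coloring G ℓ) (x : Fin ℓ) →
                         ∃ λ y → (∀ q → Adj G a q → y ≢ proj₁ α q) × x ≢ y
simplicial-free-colour {G = G} {a} simp d k<ℓ (c , proper) x
  with any? (λ y → all? (λ q → Adj? G a q →-dec ¬? (y ≟ c q)) ×-dec ¬? (x ≟ y))
... | yes free = free
... | no none = ⊥-elim (<⇒≱ k<ℓ (clique-bound {G = G} d (proj₁ ∘ pick) clique))
  where
  a-coloured-x : c a ≡ x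
  a-coloured-x with c a ≟ x
  ... | yes ca≡x = ca≡x
  ... | no ca≢x = ⊥-elim (none (c a , proper a , ≢-sym ca≢x))

  pick : ∀ y → ∃ λ q → (q ≡ a ⊎ Adj G a q) × c q ≡ y
  pick y with x ≟ y | any? (λ q → Adj? G a q ×-dec (c q ≟ y))
  ... | yes refl | _ = a , inj₁ refl , a-coloured-x
  ... | no _ | yes (q , a~q , cq≡y) = q , inj₂ a~q , cq≡y
  ... | no x≢y | no absent =
    ⊥-elim (none (y , (λ q a~q y≡cq → absent (q , a~q , ≡.sym y≡cq)) , x≢y))

  clique : ∀ {i j} → i ≢ j → Adj G (proj₁ (pick i)) (proj₁ (pick j))
  clique {i} {j} i≢j =
    let _ , near-i , coloured-i = pick i
        _ , near-j , coloured-j = pick j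
    in simplicial-closed-clique {G = G} simp near-i near-j
         λ same → i≢j (≡.trans (≡.sym coloured-i) (≡.trans (cong c same) coloured-j))

simplicial-deletion : ∀ {m k ℓ} (G : Graph (suc m)) {u} → Simplicial G u → Coloring G k → k < ℓ →
                      RConnected (G - u) ℓ → RConnected G ℓ
simplicial-deletion G {u} simp d k<ℓ = Deletion.deletion-connected G u _ λ α _ x _ →
  let y , y-fresh , x≢y = simplicial-free-colour {G = G} simp d k<ℓ α x in y , y-fresh , const x≢y

dominated-deletion : ∀ {m ℓ} (G : Graph (suc m)) {u v} → v ≢ u → (∀ x → Adj G x u → Adj G x v) →
                     RConnected (G - u) ℓ → RConnected G ℓ
dominated-deletion G {u} {v} v≢u Nu⊆Nv = Deletion.deletion-connected G u _ λ (c , proper) t _ fresh →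
  c v , (λ q u~q → proper v q (adj-sym G (Nu⊆Nv q (adj-sym G u~q)))) ,
  λ t~u → fresh v v≢u (Nu⊆Nv t t~u)

-- Separations

injective-missing⇒< : ∀ {m n} {f : Fin m → Fin n} {z} → Injective _≡_ _≡_ f →
                      (∀ i → f i ≢ z) → m < n
injective-missing⇒< {n = suc n} {f} {z} f-injective missing =
  s≤s (injective⇒≤ {f = λ i → punchOut (z≢f i)}
         λ same → f-injective (punchOut-injective (z≢f _) (z≢f _) same))
  where
  z≢f : ∀ i → z ≢ f i
  z≢f i = ≢-sym (missing i)

record Enumeration {n} (S : Fin n → Bool) : Set where
  field
    size : ℕ
    at : Fin size → Fin n
    at-injective : Injective _≡_ _≡_ at
    at-∈ : ∀ i → In S (at i)
    at-onto : ∀ {v} → In S v → ∃ λ i → at i ≡ v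

  agree-on : ∀ {A : Set} (c d : Fin n → A) → c ∘ at ≗ d ∘ at → ∀ {v} → In S v → c v ≡ d v
  agree-on c d c≗d v∈S with i , refl ← at-onto v∈S = c≗d i

  size< : ∀ {z} → ¬ In S z → size < n
  size< z∉S = injective-missing⇒< at-injective λ i at-i≡z → z∉S (subst (In S) at-i≡z (at-∈ i))

extend : ∀ {n} {S : Fin (suc n) → Bool} → Dec (In S zero) → Enumeration (S ∘ suc) → Enumeration S
extend {S = S} (no 0∉S) E = record
  { size = size
  ; at = suc ∘ at
  ; at-injective = λ same → at-injective (suc-injective same)
  ; at-∈ = at-∈
  ; at-onto = onto
  }
  where
  open Enumeration E
  onto : ∀ {v} → In S v → ∃ λ i → suc (at i) ≡ v
  onto {zero} 0∈S = ⊥-elim (0∉S 0∈S)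
  onto {suc v} v∈S = Product.map₂ (cong suc) (at-onto v∈S)
extend {S = S} (yes 0∈S) E = record
  { size = suc size
  ; at = zero ∷ suc ∘ at
  ; at-injective = λ {i} {j} → injective i j
  ; at-∈ = λ { zero → 0∈S ; (suc i) → at-∈ i }
  ; at-onto = onto
  }
  where
  open Enumeration E
  injective : ∀ i j → (zero ∷ suc ∘ at) i ≡ (zero ∷ suc ∘ at) j → i ≡ j
  injective zero zero _ = refl
  injective zero (suc j) ()
  injective (suc i) zero ()
  injective (suc i) (suc j) same = cong suc (at-injective (suc-injective same))
  onto : ∀ {v} → In S v → ∃ λ i → (zero ∷ suc ∘ at) i ≡ v
  onto {zero} _ = zero , refl
  onto {suc v} v∈S = Product.map suc (cong suc) (at-onto v∈S)

enumerate : ∀ {n} (S : Fin n → Bool) → Enumeration S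
enumerate {zero} S = record
  { size = 0 ; at = λ () ; at-injective = λ { {()} } ; at-∈ = λ () ; at-onto = λ { {()} } }
enumerate {suc n} S = extend (In? S zero) (enumerate (S ∘ suc))

_[_] : ∀ {n} (G : Graph n) (S : Fin n → Bool) → Graph (Enumeration.size (enumerate S))
G [ S ] = induced G (Enumeration.at (enumerate S))

Separated : ∀ {n} → Graph n → (Fin n → Bool) → Set
Separated G S = ∀ p q → In S p → ¬ In S q → ¬ Adj G p q

module _ {n} {S : Fin n → Bool} where

  in-or-out : ∀ v → In S v ⊎ In (not ∘ S) v
  in-or-out v with In? S v
  ... | yes v∈S = inj₁ v∈S
  ... | no v∉S = inj₂ (cong not (¬-not v∉S))

  not-in-both : ∀ {v} → In S v → ¬ In (not ∘ S) v
  not-in-both v∈S v∈S̄ with ≡.trans (≡.sym (cong not v∈S)) v∈S̄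
  ... | ()

  separated-complement : ∀ {G : Graph n} → Separated G S → Separated G (not ∘ S)
  separated-complement {G} sep p q p∈S̄ q∉S̄ p~q =
    sep q p ([ id , ⊥-elim ∘ q∉S̄ ]′ (in-or-out q)) (λ p∈S → not-in-both p∈S p∈S̄) (adj-sym G p~q)

module SideLifting {n} (G : Graph n) (S : Fin n → Bool) (sep : Separated G S) (ℓ : ℕ) where
  open Enumeration (enumerate S) public
  open Lifting G at ℓ (λ v → ¬ In S v) public

  step-lift : StepLift
  step-lift α γ i agree =
    lift-move at-injective α γ i agree fresh
      λ v v∉S v≡at-i → v∉S (subst (In S) (≡.sym v≡at-i) (at-∈ i))
    where
    fresh : ∀ q → Adj G (at i) q → proj₁ γ i ≢ proj₁ α q
    fresh q at-i~q with In? S q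
    ... | no q∉S = ⊥-elim (sep _ _ (at-∈ i) q∉S at-i~q)
    ... | yes q∈S with j , refl ← at-onto q∈S = move-target-fresh α γ i agree j at-i~q

separation-connected : ∀ {n ℓ} (G : Graph n) (S : Fin n → Bool) → Separated G S →
                       RConnected (G [ S ]) ℓ → RConnected (G [ not ∘ S ]) ℓ → RConnected G ℓ
separation-connected {ℓ = ℓ} G S sep connected-S connected-S̄ α β =
  let α₁ , α⇝α₁ , α₁≗β-on-S , _ =
        Inside.lift-path Inside.step-lift
          (connected-S (restrict G _ α) (restrict G _ β)) α (λ _ → refl)
      α₂ , α₁⇝α₂ , α₂≗β-on-S̄ , α₂-fixes-S =
        Outside.lift-path Outside.step-lift
          (connected-S̄ (restrict G _ α₁) (restrict G _ β)) α₁ (λ _ → refl)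
      α₂≗β : proj₁ α₂ ≗ proj₁ β
      α₂≗β v = [ (λ v∈S → ≡.trans (α₂-fixes-S v (not-in-both {S = S} v∈S))
                                   (Inside.agree-on (proj₁ α₁) (proj₁ β) α₁≗β-on-S v∈S))
               , Outside.agree-on (proj₁ α₂) (proj₁ β) α₂≗β-on-S̄ ]′ (in-or-out {S = S} v)
  in reachable-trans α⇝α₁ (reachable-trans α₁⇝α₂ (here α₂≗β))
  where
  module Inside = SideLifting G S sep ℓ
  module Outside = SideLifting G (not ∘ S) (separated-complement {G = G} sep) ℓ

-- Modules of diamond-free graphs

diamond-non-adjacent : ∀ i j → diamondAdj i j ≡ false →
                       i ≡ j ⊎ (i ≡ 0F × j ≡ 3F) ⊎ (i ≡ 3F × j ≡ 0F)
diamond-non-adjacent = toWitness {a? = all? λ i → all? λ j → diamondAdj i j Bool.≟ false →-dec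
  (i ≟ j ⊎-dec (i ≟ 0F ×-dec j ≟ 3F) ⊎-dec (i ≟ 3F ×-dec j ≟ 0F))} tt

common-neighbours-adjacent : ∀ {n} {G : Graph n} {a b p q} → DiamondFree G → Adj G a b →
                             Adj G a p → Adj G b p → Adj G a q → Adj G b q → p ≢ q → Adj G p q
common-neighbours-adjacent {G = G} {a} {b} {p} {q} diamond-free a~b a~p b~p a~q b~q p≢q with Adj? G p q
... | yes p~q = p~q
... | no p≁q = ⊥-elim (diamond-free record { f = f ; inj = injective ; adj-pres = adj-pres })
  where
  f : Fin 4 → Fin _
  f 0F = p
  f 1F = a
  f 2F = b
  f 3F = q

  adj-pres : ∀ i j → adj G (f i) (f j) ≡ diamondAdj i j
  adj-pres 0F 0F = irrefl G p
  adj-pres 0F 1F = adj-sym G a~p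
  adj-pres 0F 2F = adj-sym G b~p
  adj-pres 0F 3F = ¬-not p≁q
  adj-pres 1F 0F = a~p
  adj-pres 1F 1F = irrefl G a
  adj-pres 1F 2F = a~b
  adj-pres 1F 3F = a~q
  adj-pres 2F 0F = b~p
  adj-pres 2F 1F = adj-sym G a~b
  adj-pres 2F 2F = irrefl G b
  adj-pres 2F 3F = b~q
  adj-pres 3F 0F = ≡.trans (Graph.sym G q p) (¬-not p≁q)
  adj-pres 3F 1F = adj-sym G a~q
  adj-pres 3F 2F = adj-sym G b~q
  adj-pres 3F 3F = irrefl G q

  injective : Injective _≡_ _≡_ f
  injective {i} {j} fi≡fj
    with diamond-non-adjacent i j
           (≡.trans (≡.sym (adj-pres i j))
                    (subst (λ v → adj G (f i) v ≡ false) fi≡fj (irrefl G (f i))))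
  ... | inj₁ i≡j = i≡j
  ... | inj₂ (inj₁ (refl , refl)) = ⊥-elim (p≢q fi≡fj)
  ... | inj₂ (inj₂ (refl , refl)) = ⊥-elim (p≢q (≡.sym fi≡fj))

module-complete : ∀ {n} {G : Graph n} {S w x} → IsModule G S → ¬ In S w → In S x → Adj G w x →
                  ∀ v → In S v → Adj G w v
module-complete (_ , homogeneous) w∉S x∈S w~x with homogeneous _ w∉S
... | inj₁ complete = complete
... | inj₂ anticomplete = ⊥-elim (anticomplete _ x∈S w~x)

module-simplicial : ∀ {n} {G : Graph n} {S w a b} → DiamondFree G → IsModule G S →
                    ¬ In S w → (∀ v → In S v → Adj G w v) →
                    In S a → In S b → Adj G a b → Simplicial G a
module-simplicial {G = G} {S} {w} {a} {b} diamond-free mod w∉S w-complete a∈S b∈S a~b = simplicial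
  where
  a~w : Adj G a w
  a~w = adj-sym G (w-complete a a∈S)

  Na⊆Nb : ∀ y → Adj G a y → y ≢ b → Adj G y b
  Na⊆Nb y a~y y≢b with In? S y
  ... | yes y∈S =
    common-neighbours-adjacent diamond-free a~w a~y (w-complete y y∈S) a~b (w-complete b b∈S) y≢b
  ... | no y∉S = module-complete {G = G} mod y∉S a∈S (adj-sym G a~y) b b∈S

  simplicial : Simplicial G a
  simplicial p q a~p a~q p≢q with p ≟ b | q ≟ b
  ... | yes refl | _ = adj-sym G (Na⊆Nb q a~q (≢-sym p≢q))
  ... | no p≢b | yes refl = Na⊆Nb p a~p p≢b
  ... | no p≢b | no q≢b =
    common-neighbours-adjacent diamond-free a~b a~p (adj-sym G (Na⊆Nb p a~p p≢b))
      a~q (adj-sym G (Na⊆Nb q a~q q≢b)) p≢q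

data Reduction {n} (G : Graph n) : Set where
  separation : ∀ S {u z} → Separated G S → In S u → ¬ In S z → Reduction G
  simplicial : ∀ a → Simplicial G a → Reduction G
  dominated  : ∀ u v → v ≢ u → (∀ x → Adj G x u → Adj G x v) → Reduction G

module-reduction : ∀ {n} {G : Graph n} {S} → DiamondFree G → NonTrivialModule G S → Reduction G
module-reduction {G = G} {S} diamond-free (mod , (z , z∉S) , (u , v , u≢v , u∈S , v∈S))
  with any? (λ w → ¬? (In? S w) ×-dec any? λ x → In? S x ×-dec Adj? G w x)
... | no isolated =
  separation S (λ p q p∈S q∉S p~q → isolated (q , q∉S , p , p∈S , adj-sym G p~q)) u∈S z∉S
... | yes (w , w∉S , x , x∈S , w~x)
  with any? (λ a → any? λ b → In? S a ×-dec In? S b ×-dec Adj? G a b)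
...   | yes (a , b , a∈S , b∈S , a~b) =
  simplicial a (module-simplicial diamond-free mod w∉S (module-complete {G = G} mod w∉S x∈S w~x)
                 a∈S b∈S a~b)
...   | no independent = dominated u v (≢-sym u≢v) Nu⊆Nv
  where
  Nu⊆Nv : ∀ y → Adj G y u → Adj G y v
  Nu⊆Nv y y~u with In? S y
  ... | yes y∈S = ⊥-elim (independent (y , u , y∈S , u∈S , y~u))
  ... | no y∉S = module-complete {G = G} mod y∉S u∈S y~u v v∈S

nonTrivialModule? : ∀ {n} (G : Graph n) → Decidable (NonTrivialModule G)
nonTrivialModule? G S =
  (any? (In? S) ×-dec all? λ w → ¬? (In? S w) →-dec
      (all? (λ v → In? S v →-dec Adj? G w v) ⊎-dec all? (λ v → In? S v →-dec ¬? (Adj? G w v))))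
  ×-dec any? (¬? ∘ In? S)
  ×-dec any? λ u → any? λ v → ¬? (u ≟ v) ×-dec In? S u ×-dec In? S v

nonTrivialModule-resp : ∀ {n} {G : Graph n} {S S′} → S ≗ S′ →
                        NonTrivialModule G S → NonTrivialModule G S′
nonTrivialModule-resp {S = S} {S′} S≗S′
  (((v , v∈S) , homogeneous) , (z , z∉S) , (a , b , a≢b , a∈S , b∈S)) =
  ((v , to v∈S) , λ w w∉S′ → Sum.map (λ h x → h x ∘ from) (λ h x → h x ∘ from) (homogeneous w (w∉S′ ∘ to)))
  , (z , z∉S ∘ from) , (a , b , a≢b , to a∈S , to b∈S)
  where
  to : ∀ {x} → In S x → In S′ x
  to {x} = ≡.trans (≡.sym (S≗S′ x))
  from : ∀ {x} → In S′ x → In S x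
  from {x} = ≡.trans (S≗S′ x)

prime-or-reducible : ∀ {n} (G : Graph n) → DiamondFree G → Prime G ⊎ Reduction G
prime-or-reducible {n} G diamond-free
  with search-functions search-Bool n (nonTrivialModule-resp {G = G}) (nonTrivialModule? G)
... | no no-module = inj₁ λ S nonTrivial → no-module (S , nonTrivial)
... | yes (S , nonTrivial) = inj₂ (module-reduction diamond-free nonTrivial)

reducible-recolorable : ∀ {n} (G : Graph n) → Reduction G →
                        (∀ {m} (H : Graph m) → m < n → InducedEmbedding H G → RecolorableAbove H) →
                        RecolorableAbove G
reducible-recolorable {suc m} G (simplicial a simp) smaller colorable k<ℓ =
  simplicial-deletion G simp colorable k<ℓ
    (smaller (G - a) (n<1+n m) (deletion-embedding G a) (restrict G _ colorable) k<ℓ)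
reducible-recolorable {suc m} G (dominated u v v≢u Nu⊆Nv) smaller colorable k<ℓ =
  dominated-deletion G v≢u Nu⊆Nv
    (smaller (G - u) (n<1+n m) (deletion-embedding G u) (restrict G _ colorable) k<ℓ)
reducible-recolorable G (separation S sep u∈S z∉S) smaller colorable k<ℓ =
  separation-connected G S sep
    (smaller (G [ S ]) (Inside.size< z∉S) (induced-embedding G Inside.at-injective)
      (restrict G _ colorable) k<ℓ)
    (smaller (G [ not ∘ S ]) (Outside.size< (not-in-both {S = S} u∈S))
      (induced-embedding G Outside.at-injective) (restrict G _ colorable) k<ℓ)
  where
  module Inside = Enumeration (enumerate S)
  module Outside = Enumeration (enumerate (not ∘ S))

theorem12 : (𝒢 : GraphClass) → Hereditary 𝒢 →
    (∀ {n} (G : Graph n) → 𝒢 G → DiamondFree G) →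
    (∀ {n} (G : Graph n) → 𝒢 G → Prime G → Recolorable G) →
    ∀ {n} (G : Graph n) → 𝒢 G → Recolorable G
theorem12 𝒢 hereditary diamond-free prime-recolorable {n} G G∈𝒢 =
  recolorableAbove⇒recolorable G (<-rec Recolorable𝒢 inductive-step n G G∈𝒢)
  where
  Recolorable𝒢 : ℕ → Set
  Recolorable𝒢 n = (G : Graph n) → 𝒢 G → RecolorableAbove G

  inductive-step : ∀ n → (∀ {m} → m < n → Recolorable𝒢 m) → Recolorable𝒢 n
  inductive-step n smaller G G∈𝒢 with prime-or-reducible G (diamond-free G G∈𝒢)
  ... | inj₁ prime = recolorable⇒recolorableAbove G (prime-recolorable G G∈𝒢 prime)
  ... | inj₂ reduction = reducible-recolorable G reduction λ H m<n H↪G →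
    smaller m<n H (hereditary H G H↪G G∈𝒢)
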